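{- Every permutation matrix that has a spanning oscillation of length $4$ has a vertical witness.
   Context: A permutation matrix is a square 0-1 matrix with exactly one 1 in each row and column. 1-entries are identified with positions $(i,j)$ ($i$ = row from the top, $j$ = column from the left); above/below/left/right refer to comparing these coordinates. $\ell_P,r_P,t_P,b_P$ denote the leftmost, rightmost, topmost and bottommost 1-entries of $P$. The permutation graph $G_P$ has the 1-entries of $P$ as vertices, with an edge between $x$ and $y$ iff one is below and to the left of the other. An oscillation is a sequence $(x_1,\dots,x_m)$ of distinct 1-entries forming an induced path in $G_P$; it is spanning if $\{x_1,x_2\}=\{\ell_P,t_P\}$ and $\{x_{m-1},x_m\}=\{b_P,r_P\}$. A matrix $M$ contains $P$ if $P$ can be obtained from $M$ by deleting rows and/or columns and turning 1-entries into 0s; otherwise $M$ avoids $P$. A row of $M$ is $P$-expandable if it is all-zero and changing any single entry of that row to 1 creates an occurrence of $P$ in $M$. A vertical witness for $P$ is a 0-1 matrix (of any size) that avoids $P$ and has a $P$-expandable row. -}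

module Defs where

open import Data.Nat using (ℕ; suc; _+_; _<_; _≤_; _>_; s≤s; z≤n)
open import Data.Nat.Properties using (≤-trans; n<1+n; n≤1+n)
open import Data.Fin using (Fin; toℕ; _≟_; fromℕ<)
open import Data.Bool using (Bool; true; false; if_then_else_; _∧_)
open import Data.Product using (Σ; ∃; _×_; _,_; proj₁; proj₂)
open import Data.Sum using (_⊎_)
open import Data.Vec using (Vec; lookup)
open import Relation.Nullary using (¬_)
open import Relation.Nullary.Decidable using (⌊_⌋)
open import Relation.Binary.PropositionalEquality using (_≡_)
open import Function.Bundles using (_⇔_)

-- A 0-1 matrix with m rows and n columns; entry (i , j) is row i (from the top),
-- column j (from the left). true = 1, false = 0.
Matrix : ℕ → ℕ → Set
Matrix m n = Fin m → Fin n → Bool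

Pos : ℕ → Set
Pos k = Fin k × Fin k

row col : ∀ {k} → Pos k → ℕ
row x = toℕ (proj₁ x)
col x = toℕ (proj₂ x)

One : ∀ {k} → Matrix k k → Pos k → Set
One P x = P (proj₁ x) (proj₂ x) ≡ true

IsPermutationMatrix : ∀ {k} → Matrix k k → Set
IsPermutationMatrix {k} P =
  (∀ (i : Fin k) → ∃ λ (j : Fin k) → P i j ≡ true × (∀ j′ → P i j′ ≡ true → j′ ≡ j)) ×
  (∀ (j : Fin k) → ∃ λ (i : Fin k) → P i j ≡ true × (∀ i′ → P i′ j ≡ true → i′ ≡ i))

IsLeftmost IsRightmost IsTopmost IsBottommost : ∀ {k} → Matrix k k → Pos k → Set
IsLeftmost   P x = One P x × (∀ y → One P y → col x ≤ col y)
IsRightmost  P x = One P x × (∀ y → One P y → col y ≤ col x)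
IsTopmost    P x = One P x × (∀ y → One P y → row x ≤ row y)
IsBottommost P x = One P x × (∀ y → One P y → row y ≤ row x)

BelowLeft : ∀ {k} → Pos k → Pos k → Set
BelowLeft x y = row x > row y × col x < col y

Adj : ∀ {k} → Pos k → Pos k → Set
Adj x y = BelowLeft x y ⊎ BelowLeft y x

IsOscillation : ∀ {k m} → Matrix k k → Vec (Pos k) m → Set
IsOscillation {k} {m} P xs =
  (∀ a → One P (lookup xs a)) ×
  (∀ a b → lookup xs a ≡ lookup xs b → a ≡ b) ×
  (∀ a b → Adj (lookup xs a) (lookup xs b) ⇔ (suc (toℕ a) ≡ toℕ b ⊎ suc (toℕ b) ≡ toℕ a))

SamePair : ∀ {A : Set} → A → A → A → A → Set
SamePair u v x y = (u ≡ x × v ≡ y) ⊎ (u ≡ y × v ≡ x)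

IsSpanningOscillation : ∀ {k m} → Matrix k k → Vec (Pos k) (2 + m) → Set
IsSpanningOscillation {k} {m} P xs =
  IsOscillation P xs ×
  (∃ λ ℓ → ∃ λ t → IsLeftmost P ℓ × IsTopmost P t ×
     SamePair (lookup xs (fromℕ< first)) (lookup xs (fromℕ< second)) ℓ t) ×
  (∃ λ b → ∃ λ r → IsBottommost P b × IsRightmost P r ×
     SamePair (lookup xs (fromℕ< penult)) (lookup xs (fromℕ< last)) b r)
  where
  first : 0 < 2 + m
  first = s≤s z≤n
  second : 1 < 2 + m
  second = s≤s (s≤s z≤n)
  penult : m < 2 + m
  penult = s≤s (n≤1+n m)
  last : suc m < 2 + m
  last = n<1+n (suc m)

StrictlyIncreasing : ∀ {a b} → (Fin a → Fin b) → Set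
StrictlyIncreasing {a} f = ∀ (i j : Fin a) → toℕ i < toℕ j → toℕ (f i) < toℕ (f j)

Contains : ∀ {m n k l} → Matrix m n → Matrix k l → Set
Contains {m} {n} {k} {l} M P =
  Σ (Fin k → Fin m) λ ρ → Σ (Fin l → Fin n) λ γ →
    StrictlyIncreasing ρ × StrictlyIncreasing γ ×
    (∀ i j → P i j ≡ true → M (ρ i) (γ j) ≡ true)

Avoids : ∀ {m n k l} → Matrix m n → Matrix k l → Set
Avoids M P = ¬ Contains M P

set1 : ∀ {m n} → Matrix m n → Fin m → Fin n → Matrix m n
set1 M i j a b = if ⌊ a ≟ i ⌋ ∧ ⌊ b ≟ j ⌋ then true else M a b

IsExpandableRow : ∀ {m n k l} → Matrix k l → Matrix m n → Fin m → Set
IsExpandableRow {n = n} P M i =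
  (∀ (j : Fin n) → M i j ≡ false) × (∀ (j : Fin n) → Contains (set1 M i j) P)

VerticalWitness : ∀ {k} → Matrix k k → Set
VerticalWitness P =
  Σ ℕ λ m → Σ ℕ λ n → Σ (Matrix (suc m) (suc n)) λ M →
    Avoids M P × ∃ λ i → IsExpandableRow P M i

{-# OPTIONS --safe #-}
-- The corners ℓ_P, t_P, b_P, r_P of P lie in the first column, first row, last row and last
-- column, and a spanning oscillation of length 4 is either (t_P, ℓ_P, r_P, b_P) or
-- (ℓ_P, t_P, b_P, r_P).  Reversing the order of the columns complements G_P, exchanges the two
-- shapes and preserves vertical witnesses, so only the first shape needs a construction: there
-- r_P lies some d > 0 rows above ℓ_P, and two copies of P offset by d rows (one missing r_P's
-- column, the other ℓ_P's) leave the row of ℓ_P empty but make it P-expandable.  Along an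
-- occurrence of P the row offset ρ a − a never decreases and stays within [0, d], and chasing
-- the corners forces it to be d at r_P, which would put r_P into the empty row.
module Submission where

open import Defs
open import Data.Nat using (ℕ; zero; suc; _+_; _∸_; _<_; _≤_; _<?_; s≤s; s≤s⁻¹)
open import Data.Nat.Properties
open import Data.Fin as F using (Fin; zero; suc; toℕ; fromℕ; fromℕ<; opposite; _↑ˡ_; _↑ʳ_)
open import Data.Fin.Properties
  using (toℕ-injective; toℕ<n; toℕ≤pred[n]; toℕ-fromℕ; toℕ-fromℕ<; ≤fromℕ;
         toℕ-↑ˡ; toℕ-↑ʳ; opposite-prop; opposite-involutive; any?)
open import Data.Bool using (true; false; _∧_)
open import Data.Bool.Properties using () renaming (_≟_ to _≟ᵇ_)
open import Data.Product using (Σ; ∃; ∃₂; _×_; _,_; proj₁; proj₂)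
open import Data.Sum using (_⊎_; inj₁; inj₂)
open import Data.Vec using (Vec; _∷_; [])
open import Data.Empty using (⊥-elim)
open import Function using (_∘_)
open import Function.Bundles using (Equivalence)
open import Relation.Nullary using (¬_; Dec; yes; no; does; ¬?)
open import Relation.Nullary.Decidable using (⌊_⌋; _×-dec_; _⊎-dec_; dec-true; dec-false)
open import Relation.Binary.PropositionalEquality

does-true⇒ : ∀ {A : Set} (a? : Dec A) → does a? ≡ true → A
does-true⇒ (yes a) _ = a
does-true⇒ (no _) ()

opposite-< : ∀ {n} {i j : Fin n} → toℕ i < toℕ j → toℕ (opposite j) < toℕ (opposite i)
opposite-< {i = i} {j} i<j rewrite opposite-prop i | opposite-prop j =
  ∸-monoʳ-< (s≤s i<j) (toℕ<n j)

opposite-injective : ∀ {n} {i j : Fin n} → opposite i ≡ opposite j → i ≡ j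
opposite-injective {i = i} {j} eq =
  trans (sym (opposite-involutive i)) (trans (cong opposite eq) (opposite-involutive j))

module _ {m n} (M : Matrix m n) (i : Fin m) (j : Fin n) where

  set1-hit : set1 M i j i j ≡ true
  set1-hit with i F.≟ i | j F.≟ j
  ... | yes _ | yes _ = refl
  ... | no i≢i | _    = ⊥-elim (i≢i refl)
  ... | yes _ | no j≢j = ⊥-elim (j≢j refl)

  set1-keep : ∀ {a b} → M a b ≡ true → set1 M i j a b ≡ true
  set1-keep {a} {b} h with ⌊ a F.≟ i ⌋ ∧ ⌊ b F.≟ j ⌋
  ... | true  = refl
  ... | false = h

  set1-true : ∀ {a b} → set1 M i j a b ≡ true → (a ≡ i × b ≡ j) ⊎ M a b ≡ true
  set1-true {a} {b} h with a F.≟ i | b F.≟ j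
  ... | yes a≡i | yes b≡j = inj₁ (a≡i , b≡j)
  ... | yes _   | no _    = inj₂ h
  ... | no _    | _       = inj₂ h

Contains-mono : ∀ {m n k l} {M M′ : Matrix m n} {P P′ : Matrix k l} →
                (∀ a b → M a b ≡ true → M′ a b ≡ true) →
                (∀ i j → P′ i j ≡ true → P i j ≡ true) →
                Contains M P → Contains M′ P′
Contains-mono M⊆M′ P′⊆P (ρ , γ , ρ↑ , γ↑ , occ) =
  ρ , γ , ρ↑ , γ↑ , λ i j h → M⊆M′ _ _ (occ i j (P′⊆P i j h))

reflect : ∀ {m n} → Matrix m n → Matrix m n
reflect M i j = M i (opposite j)

reflect-reflect : ∀ {m n} (M : Matrix m n) i j → reflect (reflect M) i j ≡ M i j
reflect-reflect M i j = cong (M i) (opposite-involutive j)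

reflect-contains : ∀ {m n k l} {M : Matrix m n} {P : Matrix k l} →
                   Contains M P → Contains (reflect M) (reflect P)
reflect-contains {M = M} (ρ , γ , ρ↑ , γ↑ , occ) =
  ρ , opposite ∘ γ ∘ opposite , ρ↑ ,
  (λ i j i<j → opposite-< (γ↑ _ _ (opposite-< i<j))) ,
  λ i j h → trans (reflect-reflect M (ρ i) (γ (opposite j))) (occ i (opposite j) h)

reflect-permutation : ∀ {k} {P : Matrix k k} → IsPermutationMatrix P → IsPermutationMatrix (reflect P)
reflect-permutation {P = P} (rows , cols) = reflectRow , cols ∘ opposite
  where
  reflectRow : ∀ i → ∃ λ j → reflect P i j ≡ true × (∀ j′ → reflect P i j′ ≡ true → j′ ≡ j)
  reflectRow i with rows i
  ... | j , Pij , unique =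
    opposite j ,
    subst (λ c → P i c ≡ true) (sym (opposite-involutive j)) Pij ,
    λ j′ h → trans (sym (opposite-involutive j′)) (cong opposite (unique _ h))

reflect-verticalWitness : ∀ {k} {P : Matrix k k} → VerticalWitness (reflect P) → VerticalWitness P
reflect-verticalWitness {P = P} (m , n , M , M-avoids , i , zeros , expand) =
  m , n , reflect M , reflect-avoids , i , zeros ∘ opposite , reflect-expand
  where
  reflect-avoids : Avoids (reflect M) P
  reflect-avoids =
    M-avoids ∘ Contains-mono (λ a b → trans (sym (reflect-reflect M a b))) (λ _ _ h → h)
             ∘ reflect-contains {M = reflect M} {P = P}

  unreflect-set1 : ∀ j a b → reflect (set1 M i (opposite j)) a b ≡ true → set1 (reflect M) i j a b ≡ true
  unreflect-set1 j a b h with set1-true M i (opposite j) h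
  ... | inj₁ (refl , eq) rewrite opposite-injective {i = b} {j = j} eq = set1-hit (reflect M) i j
  ... | inj₂ Mab = set1-keep (reflect M) i j Mab

  reflect-expand : ∀ j → Contains (set1 (reflect M) i j) P
  reflect-expand j =
    Contains-mono (unreflect-set1 j) (λ a b → trans (reflect-reflect P a b))
      (reflect-contains {M = set1 M i (opposite j)} {P = reflect P} (expand (opposite j)))

module _ {k m} {ρ : Fin k → Fin m} (ρ↑ : StrictlyIncreasing ρ) where

  spread : ∀ j {a b : Fin k} → toℕ a + j ≡ toℕ b → toℕ (ρ a) + j ≤ toℕ (ρ b)
  spread zero {a} a+0≡b with toℕ-injective (trans (sym (+-identityʳ (toℕ a))) a+0≡b)
  ... | refl = ≤-reflexive (+-identityʳ _)
  spread (suc j) {a} {b} a+1+j≡b =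
    subst (_≤ toℕ (ρ b)) (sym (+-suc (toℕ (ρ a)) j))
      (≤-<-trans (spread j (sym (toℕ-fromℕ< c<k))) (ρ↑ c b c<b))
    where
    a+j<b : toℕ a + j < toℕ b
    a+j<b = ≤-reflexive (trans (sym (+-suc (toℕ a) j)) a+1+j≡b)
    c<k : toℕ a + j < k
    c<k = <-trans a+j<b (toℕ<n b)
    c : Fin k
    c = fromℕ< c<k
    c<b : toℕ c < toℕ b
    c<b = subst (_< toℕ b) (sym (toℕ-fromℕ< c<k)) a+j<b

  displaced-mono : ∀ {a b} → toℕ a ≤ toℕ b → toℕ a < toℕ (ρ a) → toℕ b < toℕ (ρ b)
  displaced-mono {a} {b} a≤b a<ρa = begin-strict
    toℕ b                       ≡⟨ m+[n∸m]≡n a≤b ⟨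
    toℕ a + (toℕ b ∸ toℕ a)     <⟨ +-monoˡ-< _ a<ρa ⟩
    toℕ (ρ a) + (toℕ b ∸ toℕ a) ≤⟨ spread _ (m+[n∸m]≡n a≤b) ⟩
    toℕ (ρ b)                   ∎
    where open ≤-Reasoning

module _ {n m} {ρ : Fin (suc n) → Fin m} (ρ↑ : StrictlyIncreasing ρ) where

  lower-bound : ∀ a → toℕ (ρ zero) + toℕ a ≤ toℕ (ρ a)
  lower-bound a = spread ρ↑ (toℕ a) refl

module _ {n d} {ρ : Fin (suc n) → Fin (suc n + d)} (ρ↑ : StrictlyIncreasing ρ) where

  upper-bound : ∀ a → toℕ (ρ a) ≤ d + toℕ a
  upper-bound a = +-cancelʳ-≤ (n ∸ toℕ a) (toℕ (ρ a)) (d + toℕ a) (begin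
    toℕ (ρ a) + (n ∸ toℕ a)   ≤⟨ spread ρ↑ _ (trans (m+[n∸m]≡n a≤n) (sym (toℕ-fromℕ n))) ⟩
    toℕ (ρ (fromℕ n))         ≤⟨ s≤s⁻¹ (toℕ<n (ρ (fromℕ n))) ⟩
    n + d                     ≡⟨ +-comm n d ⟩
    d + n                     ≡⟨ cong (d +_) (m+[n∸m]≡n a≤n) ⟨
    d + (toℕ a + (n ∸ toℕ a)) ≡⟨ +-assoc d (toℕ a) _ ⟨
    d + toℕ a + (n ∸ toℕ a)   ∎)
    where
    open ≤-Reasoning
    a≤n : toℕ a ≤ n
    a≤n = toℕ≤pred[n] a

module PermutationMatrix {k} {P : Matrix k k} (perm : IsPermutationMatrix P) where

  row-unique : ∀ {i j j′} → P i j ≡ true → P i j′ ≡ true → j ≡ j′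
  row-unique {i} h h′ = let (_ , _ , unique) = proj₁ perm i in trans (unique _ h) (sym (unique _ h′))

  col-unique : ∀ {i i′ j} → P i j ≡ true → P i′ j ≡ true → i ≡ i′
  col-unique {j = j} h h′ = let (_ , _ , unique) = proj₂ perm j in trans (unique _ h) (sym (unique _ h′))

  one-in-row : ∀ i → ∃ λ j → One P (i , j)
  one-in-row i = let (j , Pij , _) = proj₁ perm i in j , Pij

  one-in-col : ∀ j → ∃ λ i → One P (i , j)
  one-in-col j = let (i , Pij , _) = proj₂ perm j in i , Pij

  distinct-rows : ∀ {x y} → One P x → One P y → x ≢ y → row x ≢ row y
  distinct-rows {a , c} {a′ , c′} hx hy x≢y eq with toℕ-injective eq
  ... | refl with row-unique hx hy
  ... | refl = x≢y refl

  distinct-cols : ∀ {x y} → One P x → One P y → x ≢ y → col x ≢ col y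
  distinct-cols {a , c} {a′ , c′} hx hy x≢y eq with toℕ-injective eq
  ... | refl with col-unique hx hy
  ... | refl = x≢y refl

  nonadjacent-row< : ∀ {x y} → One P x → One P y → x ≢ y → ¬ Adj x y → col x ≤ col y → row x < row y
  nonadjacent-row< hx hy x≢y x≁y cx≤cy =
    ≤∧≢⇒< (≮⇒≥ λ ry<rx → x≁y (inj₁ (ry<rx , ≤∧≢⇒< cx≤cy (distinct-cols hx hy x≢y))))
          (distinct-rows hx hy x≢y)

  nonadjacent-col< : ∀ {x y} → One P x → One P y → x ≢ y → ¬ Adj x y → row x ≤ row y → col x < col y
  nonadjacent-col< hx hy x≢y x≁y rx≤ry =
    ≤∧≢⇒< (≮⇒≥ λ cy<cx → x≁y (inj₂ (≤∧≢⇒< rx≤ry (distinct-rows hx hy x≢y) , cy<cx)))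
          (distinct-cols hx hy x≢y)

topmost-adj : ∀ {k} {P : Matrix k k} {t y} → IsTopmost P t → One P y → Adj t y → BelowLeft y t
topmost-adj (_ , above) hy (inj₁ (ry<rt , _)) = ⊥-elim (<⇒≱ ry<rt (above _ hy))
topmost-adj _           _  (inj₂ y↙t)        = y↙t

leftmost-adj : ∀ {k} {P : Matrix k k} {ℓ y} → IsLeftmost P ℓ → One P y → Adj ℓ y → BelowLeft ℓ y
leftmost-adj _           _  (inj₁ ℓ↙y)        = ℓ↙y
leftmost-adj (_ , leftof) hy (inj₂ (_ , cy<cℓ)) = ⊥-elim (<⇒≱ cy<cℓ (leftof _ hy))

record Corners {n} (P : Matrix (suc n) (suc n)) : Set where
  field
    leftRow rightRow topCol bottomCol : Fin (suc n)
    left   : P leftRow zero ≡ true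
    right  : P rightRow (fromℕ n) ≡ true
    top    : P zero topCol ≡ true
    bottom : P (fromℕ n) bottomCol ≡ true

-- The shape of a spanning oscillation (t_P, ℓ_P, r_P, b_P).
Zigzag : ∀ {n} → Matrix (suc n) (suc n) → Set
Zigzag P = Σ (Corners P) λ c → let open Corners c in rightRow F.< leftRow × topCol F.< bottomCol

reflect-corners : ∀ {n} {P : Matrix (suc n) (suc n)} → Corners P → Corners (reflect P)
reflect-corners {P = P} c = record
  { leftRow   = rightRow
  ; rightRow  = leftRow
  ; topCol    = opposite topCol
  ; bottomCol = opposite bottomCol
  ; left      = right
  ; right     = unreflect left
  ; top       = unreflect top
  ; bottom    = unreflect bottom
  }
  where
  open Corners c
  unreflect : ∀ {i j} → P i j ≡ true → reflect P i (opposite j) ≡ true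
  unreflect {i} {j} = subst (λ c → P i c ≡ true) (sym (opposite-involutive j))

module _ {n} {P : Matrix (suc n) (suc n)} (perm : IsPermutationMatrix P) where
  open PermutationMatrix perm

  corners : ∀ {ℓ t b r} →
            IsLeftmost P ℓ → IsTopmost P t → IsBottommost P b → IsRightmost P r → Corners P
  corners {ℓ} {t} {b} {r} (Oℓ , leftof) (Ot , above) (Ob , below) (Or , rightof) = record
    { leftRow   = proj₁ ℓ
    ; rightRow  = proj₁ r
    ; topCol    = proj₂ t
    ; bottomCol = proj₂ b
    ; left      = subst (λ c → P (proj₁ ℓ) c ≡ true) (first (leftof _ (proj₂ (one-in-col zero)))) Oℓ
    ; right     = subst (λ c → P (proj₁ r) c ≡ true) (last (rightof _ (proj₂ (one-in-col (fromℕ n))))) Or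
    ; top       = subst (λ a → P a (proj₂ t) ≡ true) (first (above _ (proj₂ (one-in-row zero)))) Ot
    ; bottom    = subst (λ a → P a (proj₂ b) ≡ true) (last (below _ (proj₂ (one-in-row (fromℕ n))))) Ob
    }
    where
    first : ∀ {i : Fin (suc n)} → toℕ i ≤ 0 → i ≡ zero
    first = toℕ-injective ∘ n≤0⇒n≡0
    last : ∀ {i : Fin (suc n)} → toℕ (fromℕ n) ≤ toℕ i → i ≡ fromℕ n
    last {i} n≤i = toℕ-injective (≤-antisym (≤fromℕ i) n≤i)

  -- Two of the four matchings are impossible: t_P, r_P (and ℓ_P, b_P) are never adjacent.
  corner-order :
    ∀ {ℓ t b r x₀ x₁ x₂ x₃} →
    IsLeftmost P ℓ → IsTopmost P t → IsBottommost P b → IsRightmost P r →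
    Adj x₁ x₂ → ¬ Adj x₀ x₃ → x₀ ≢ x₃ → SamePair x₀ x₁ ℓ t → SamePair x₂ x₃ b r →
    (row r < row ℓ × col t < col b) ⊎ (row ℓ < row r × col b < col t)
  corner-order (Oℓ , leftof) T (Ob , _) (Or , _) x₁~x₂ x₀≁x₃ x₀≢x₃
               (inj₁ (refl , refl)) (inj₁ (refl , refl)) =
    inj₂ (nonadjacent-row< Oℓ Or x₀≢x₃ x₀≁x₃ (leftof _ Or) , proj₂ (topmost-adj T Ob x₁~x₂))
  corner-order _ T _ (Or , rightof) x₁~x₂ _ _ (inj₁ (refl , refl)) (inj₂ (refl , refl)) =
    ⊥-elim (<⇒≱ (proj₂ (topmost-adj T Or x₁~x₂)) (rightof _ (proj₁ T)))
  corner-order L _ (Ob , below) _ x₁~x₂ _ _ (inj₂ (refl , refl)) (inj₁ (refl , refl)) =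
    ⊥-elim (<⇒≱ (proj₁ (leftmost-adj L Ob x₁~x₂)) (below _ (proj₁ L)))
  corner-order L (Ot , above) (Ob , _) (Or , _) x₁~x₂ x₀≁x₃ x₀≢x₃
               (inj₂ (refl , refl)) (inj₂ (refl , refl)) =
    inj₁ (proj₁ (leftmost-adj L Or x₁~x₂) , nonadjacent-col< Ot Ob x₀≢x₃ x₀≁x₃ (above _ Ob))

  spanning⇒zigzag : (∃ λ (xs : Vec (Pos (suc n)) 4) → IsSpanningOscillation {m = 2} P xs) →
                    Zigzag P ⊎ Zigzag (reflect P)
  spanning⇒zigzag (x₀ ∷ x₁ ∷ x₂ ∷ x₃ ∷ [] , (_ , injective , adjacent) ,
                   (_ , _ , L , T , start) , (_ , _ , B , R , end))
    with corner-order L T B R x₁~x₂ x₀≁x₃ x₀≢x₃ start end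
    where
    x₁~x₂ : Adj x₁ x₂
    x₁~x₂ = Equivalence.from (adjacent (suc zero) (suc (suc zero))) (inj₁ refl)
    x₀≁x₃ : ¬ Adj x₀ x₃
    x₀≁x₃ x₀~x₃ with Equivalence.to (adjacent zero (suc (suc (suc zero)))) x₀~x₃
    ... | inj₁ ()
    ... | inj₂ ()
    x₀≢x₃ : x₀ ≢ x₃
    x₀≢x₃ eq with injective zero (suc (suc (suc zero))) eq
    ... | ()
  ... | inj₁ order = inj₁ (corners L T B R , order)
  ... | inj₂ (ℓ<r , b<t) = inj₂ (reflect-corners (corners L T B R) , ℓ<r , opposite-< b<t)

-- M is the union of a left copy (P without its last column, shifted down by d) and a right copy
-- (P without its first column, shifted right by n + 1).  A new 1 in the empty row replaces r_P in
-- the left copy if it lies right of column n, and ℓ_P in the right copy otherwise.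
module ZigzagWitness {n} {P : Matrix (suc n) (suc n)}
                     (perm : IsPermutationMatrix P) (zigzag : Zigzag P) where
  open PermutationMatrix perm
  open Corners (proj₁ zigzag)

  d : ℕ
  d = toℕ leftRow ∸ toℕ rightRow

  rightRow+d : toℕ rightRow + d ≡ toℕ leftRow
  rightRow+d = m+[n∸m]≡n (<⇒≤ (proj₁ (proj₂ zigzag)))

  LeftCopy RightCopy Entry : ℕ → ℕ → Set
  LeftCopy  x y = ∃₂ λ a c → P a c ≡ true × c ≢ fromℕ n × toℕ a + d ≡ x × toℕ c ≡ y
  RightCopy x y = ∃₂ λ a c → P a c ≡ true × c ≢ zero × toℕ a ≡ x × suc n + toℕ c ≡ y
  Entry     x y = LeftCopy x y ⊎ RightCopy x y

  entry? : ∀ x y → Dec (Entry x y)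
  entry? x y =
    (any? λ a → any? λ c →
       (P a c ≟ᵇ true) ×-dec ¬? (c F.≟ fromℕ n) ×-dec (toℕ a + d ≟ x) ×-dec (toℕ c ≟ y))
    ⊎-dec
    (any? λ a → any? λ c →
       (P a c ≟ᵇ true) ×-dec ¬? (c F.≟ zero) ×-dec (toℕ a ≟ x) ×-dec (suc n + toℕ c ≟ y))

  M : Matrix (suc n + d) (suc n + suc n)
  M x y = does (entry? (toℕ x) (toℕ y))

  entry : ∀ {x y} → M x y ≡ true → Entry (toℕ x) (toℕ y)
  entry {x} {y} = does-true⇒ (entry? (toℕ x) (toℕ y))

  empty : ∀ {x y} → x ≡ toℕ leftRow → ¬ Entry x y
  empty x≡ℓ (inj₁ (a , c , Pac , c≢last , refl , _))
    with toℕ-injective (+-cancelʳ-≡ d (toℕ a) (toℕ rightRow) (trans x≡ℓ (sym rightRow+d)))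
  ... | refl = c≢last (row-unique Pac right)
  empty x≡ℓ (inj₂ (a , c , Pac , c≢first , refl , _)) with toℕ-injective x≡ℓ
  ... | refl = c≢first (row-unique Pac left)

  lowRow⇒leftColumn : ∀ {x y} → Entry x y → n < x → y < suc n
  lowRow⇒leftColumn (inj₁ (_ , c , _ , _ , _ , refl)) _   = toℕ<n c
  lowRow⇒leftColumn (inj₂ (a , _ , _ , _ , refl , _)) n<a = ⊥-elim (<⇒≱ n<a (toℕ≤pred[n] a))

  leftColumn⇒shiftedRow : ∀ {x y} → Entry x y → y < suc n → d ≤ x
  leftColumn⇒shiftedRow (inj₁ (a , _ , _ , _ , refl , _)) _   = m≤n+m d (toℕ a)
  leftColumn⇒shiftedRow (inj₂ (_ , c , _ , _ , _ , refl)) y<k = ⊥-elim (<⇒≱ y<k (m≤m+n (suc n) (toℕ c)))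

  -- ℓ_P cannot stay in its (empty) row, so its offset is positive, hence so is b_P's; b_P then
  -- lies below row n, i.e. in the left copy, and so does t_P, whose offset is therefore d.
  avoids : Avoids M P
  avoids (ρ , γ , ρ↑ , γ↑ , occ) = empty ρ-rightRow (image right)
    where
    image : ∀ {a c} → P a c ≡ true → Entry (toℕ (ρ a)) (toℕ (γ c))
    image h = entry (occ _ _ h)
    leftRow-displaced : toℕ leftRow < toℕ (ρ leftRow)
    leftRow-displaced =
      ≤∧≢⇒< (≤-trans (m≤n+m _ _) (lower-bound ρ↑ leftRow)) (λ eq → empty (sym eq) (image left))
    bottom-displaced : n < toℕ (ρ (fromℕ n))
    bottom-displaced =
      subst (_< toℕ (ρ (fromℕ n))) (toℕ-fromℕ n) (displaced-mono ρ↑ (≤fromℕ leftRow) leftRow-displaced)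
    top-shifted : d ≤ toℕ (ρ zero)
    top-shifted = leftColumn⇒shiftedRow (image top)
      (<-trans (γ↑ _ _ (proj₂ (proj₂ zigzag))) (lowRow⇒leftColumn (image bottom) bottom-displaced))
    ρ-rightRow : toℕ (ρ rightRow) ≡ toℕ leftRow
    ρ-rightRow =
      trans (≤-antisym (upper-bound ρ↑ rightRow)
                       (≤-trans (+-monoˡ-≤ _ top-shifted) (lower-bound ρ↑ rightRow)))
            (trans (+-comm d (toℕ rightRow)) rightRow+d)

  shiftRow keepRow : Fin (suc n) → Fin (suc n + d)
  shiftRow a = fromℕ< (+-monoˡ-< d (toℕ<n a))
  keepRow a = a ↑ˡ d

  emptyRow : Fin (suc n + d)
  emptyRow = shiftRow rightRow

  toℕ-emptyRow : toℕ emptyRow ≡ toℕ leftRow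
  toℕ-emptyRow = trans (toℕ-fromℕ< _) rightRow+d

  keepRow-leftRow : keepRow leftRow ≡ emptyRow
  keepRow-leftRow = toℕ-injective (trans (toℕ-↑ˡ leftRow d) (sym toℕ-emptyRow))

  shiftRow↑ : StrictlyIncreasing shiftRow
  shiftRow↑ a c a<c rewrite toℕ-fromℕ< (+-monoˡ-< d (toℕ<n a)) | toℕ-fromℕ< (+-monoˡ-< d (toℕ<n c)) =
    +-monoˡ-< d a<c

  keepRow↑ : StrictlyIncreasing keepRow
  keepRow↑ a c a<c rewrite toℕ-↑ˡ a d | toℕ-↑ˡ c d = a<c

  right-occurrence : ∀ y → toℕ y < suc n → Contains (set1 M emptyRow y) P
  right-occurrence y y<k = keepRow , γ , keepRow↑ , γ↑ , occ
    where
    γ : Fin (suc n) → Fin (suc n + suc n)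
    γ zero    = y
    γ (suc c) = suc n ↑ʳ suc c
    γ↑ : StrictlyIncreasing γ
    γ↑ zero    (suc c) _ rewrite toℕ-↑ʳ (suc n) (suc c) = <-≤-trans y<k (m≤m+n (suc n) _)
    γ↑ (suc a) (suc c) a<c rewrite toℕ-↑ʳ (suc n) (suc a) | toℕ-↑ʳ (suc n) (suc c) = +-monoʳ-< (suc n) a<c
    occ : ∀ a c → P a c ≡ true → set1 M emptyRow y (keepRow a) (γ c) ≡ true
    occ a zero h rewrite col-unique h left | keepRow-leftRow = set1-hit M emptyRow y
    occ a (suc c) h = set1-keep M emptyRow y
      (dec-true (entry? _ _)
        (inj₂ (a , suc c , h , (λ ()) , sym (toℕ-↑ˡ a d) , sym (toℕ-↑ʳ (suc n) (suc c)))))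

  left-occurrence : ∀ y → suc n ≤ toℕ y → Contains (set1 M emptyRow y) P
  left-occurrence y k≤y = shiftRow , γ , shiftRow↑ , γ↑ , occ
    where
    γ : Fin (suc n) → Fin (suc n + suc n)
    γ c with c F.≟ fromℕ n
    ... | yes _ = y
    ... | no _  = c ↑ˡ suc n
    γ↑ : StrictlyIncreasing γ
    γ↑ a c a<c with a F.≟ fromℕ n | c F.≟ fromℕ n
    ... | yes refl | _     = ⊥-elim (<⇒≱ a<c (≤fromℕ c))
    ... | no _     | yes _ rewrite toℕ-↑ˡ a (suc n) = <-≤-trans (toℕ<n a) k≤y
    ... | no _     | no _  rewrite toℕ-↑ˡ a (suc n) | toℕ-↑ˡ c (suc n) = a<c
    occ : ∀ a c → P a c ≡ true → set1 M emptyRow y (shiftRow a) (γ c) ≡ true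
    occ a c h with c F.≟ fromℕ n
    ... | yes refl rewrite col-unique h right = set1-hit M emptyRow y
    ... | no c≢last = set1-keep M emptyRow y
      (dec-true (entry? _ _)
        (inj₁ (a , c , h , c≢last , sym (toℕ-fromℕ< _) , sym (toℕ-↑ˡ c (suc n)))))

  expandable : IsExpandableRow P M emptyRow
  expandable = (λ y → dec-false (entry? _ _) (empty toℕ-emptyRow)) , expand
    where
    expand : ∀ y → Contains (set1 M emptyRow y) P
    expand y with toℕ y <? suc n
    ... | yes y<k = right-occurrence y y<k
    ... | no y≮k  = left-occurrence y (≮⇒≥ y≮k)

  verticalWitness : VerticalWitness P
  verticalWitness = n + d , n + suc n , M , avoids , emptyRow , expandable

lemma1p14 : ∀ (k : ℕ) (P : Matrix k k) → IsPermutationMatrix P →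
    (∃ λ (xs : Vec (Pos k) 4) → IsSpanningOscillation {m = 2} P xs) →
    VerticalWitness P
lemma1p14 zero    P perm ((((), _) ∷ _) , _)
lemma1p14 (suc n) P perm oscillation with spanning⇒zigzag perm oscillation
... | inj₁ zigzag = ZigzagWitness.verticalWitness perm zigzag
... | inj₂ zigzag =
  reflect-verticalWitness (ZigzagWitness.verticalWitness (reflect-permutation perm) zigzag)
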